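{- The following deterministic online algorithm with advice for \textsc{MBM} is $\frac35$-competitive and uses $m$ advice bits. The oracle runs $\textsc{Ranking}(\sigma)$ on the input with $\sigma$ the identity ranking ($\sigma(b)=b$), obtaining a matching $M_G$, and sets $c(b)=1$ if $b\in B$ is not matched in $M_G$ and $c(b)=2$ otherwise; the function $c$ is given to the algorithm as $m$ advice bits. The algorithm then returns $\textsc{Ranking}(\sigma_c)$.
   Context: Online maximum bipartite matching (\textsc{MBM}): the input is a bipartite graph $G=(A,B,E)$ with $A=[n]$, $B=[m]$, $m=\Theta(n)$; the $A$-vertices, together with their incident edges, arrive one at a time in an adversarially chosen order, and upon arrival of $a\in A$ the algorithm must irrevocably match $a$ to a currently unmatched neighbour or leave it unmatched. In the advice (tape) model, an all-powerful oracle knowing the whole input (including the arrival order) writes an advice string beforehand that the algorithm may read. A deterministic algorithm is $\rho$-competitive if on every input its output matching $M$ satisfies $|M|\ge\rho|M^*|$, $M^*$ a maximum matching. $\textsc{Ranking}(\sigma)$, for a permutation $\sigma$ of $B$, matches each arriving $A$-vertex (in the input's arrival order) to its unmatched neighbour $b$ of minimum $\sigma(b)$, leaving it unmatched if none exists. For $c:B\to\{1,2\}$, $\sigma_c$ is the unique permutation of $B$ with $\sigma_c(b_1)<\sigma_c(b_2)$ iff $c(b_1)<c(b_2)$, or $c(b_1)=c(b_2)$ and $b_1<b_2$. -}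

module Defs where

open import Data.Nat using (ℕ; zero; suc; _+_; _<ᵇ_; _≡ᵇ_)
open import Data.Bool using (Bool; true; false; if_then_else_; _∧_; _∨_; not)
open import Data.Fin using (Fin; toℕ)
open import Data.Fin.Permutation using (Permutation′; _⟨$⟩ʳ_)
open import Data.List using (List; []; _∷_; map; foldl; allFin)
open import Data.Nat.ListAction using (sum)
open import Data.Bool.ListAction using (any)
open import Data.Maybe using (Maybe; just; nothing; is-just)
open import Data.Product using (_×_; _,_; proj₁)
open import Relation.Binary.PropositionalEquality using (_≡_)
open import Relation.Nullary using (does)
import Data.Fin as F

-- Bipartite graph with A = Fin n, B = Fin m, given by its adjacency relation.
Graph : ℕ → ℕ → Set
Graph n m = Fin n → Fin m → Bool

-- A (partial) assignment of A-vertices to B-vertices; a matching is represented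
-- by the partner of each A-vertex.
Assignment : ℕ → ℕ → Set
Assignment n m = Fin n → Maybe (Fin m)

IsMatching : ∀ {n m} → Graph n m → Assignment n m → Set
IsMatching {n} {m} E M =
  (∀ (a : Fin n) (b : Fin m) → M a ≡ just b → E a b ≡ true) ×
  (∀ (a a' : Fin n) (b : Fin m) → M a ≡ just b → M a' ≡ just b → a ≡ a')

size : ∀ {n m} → Assignment n m → ℕ
size {n} M = sum (map (λ a → if is-just (M a) then 1 else 0) (allFin n))

-- A ranking σ of B is given by its rank function Fin m → ℕ (smaller = preferred).
-- Among the b with ok b = true, pick the one of minimum σ b (first one on ties,
-- which never occur for injective σ).
pick : ∀ {m} → (Fin m → ℕ) → (Fin m → Bool) → Maybe (Fin m)
pick {m} σ ok = foldl step nothing (allFin m)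
  where
  step : Maybe (Fin m) → Fin m → Maybe (Fin m)
  step nothing b = if ok b then just b else nothing
  step (just b') b = if ok b ∧ (σ b <ᵇ σ b') then just b else just b'

private
  updA : ∀ {n m} → Assignment n m → Fin n → Fin m → Assignment n m
  updA M a b a' = if does (a' F.≟ a) then just b else M a'

  updU : ∀ {m} → (Fin m → Bool) → Fin m → Fin m → Bool
  updU U b b' = if does (b' F.≟ b) then true else U b'

rankingStep : ∀ {n m} → Graph n m → (Fin m → ℕ) →
              Assignment n m × (Fin m → Bool) → Fin n →
              Assignment n m × (Fin m → Bool)
rankingStep E σ (M , U) a with pick σ (λ b → E a b ∧ not (U b))
... | nothing = M , U
... | just b  = updA M a b , updU U b

-- π ⟨$⟩ʳ i is the i-th arriving A-vertex.
ranking : ∀ {n m} → Graph n m → Permutation′ n → (Fin m → ℕ) → Assignment n m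
ranking {n} E π σ =
  proj₁ (foldl (rankingStep E σ) ((λ _ → nothing) , (λ _ → false))
               (map (π ⟨$⟩ʳ_) (allFin n)))

idRank : ∀ {m} → Fin m → ℕ
idRank b = toℕ b

matchedB : ∀ {n m} → Assignment n m → Fin m → Bool
matchedB {n} M b = any (λ a → isB (M a)) (allFin n)
  where
  isB : Maybe _ → Bool
  isB nothing = false
  isB (just b') = does (b' F.≟ b)

advice : ∀ {n m} → Graph n m → Permutation′ n → Fin m → ℕ
advice E π b = if matchedB (ranking E π idRank) b then 2 else 1

-- σ_c(b) = number of b' preceding b in the order (c(b'), b') lexicographic;
-- this is (0-based) the unique permutation described in the paper.
sigmaC : ∀ {m} → (Fin m → ℕ) → Fin m → ℕ
sigmaC {m} c b = sum (map (λ b' → if before b' then 1 else 0) (allFin m))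
  where
  before : Fin m → Bool
  before b' = (c b' <ᵇ c b) ∨ ((c b' ≡ᵇ c b) ∧ (toℕ b' <ᵇ toℕ b))

algorithm : ∀ {n m} → Graph n m → Permutation′ n → Assignment n m
algorithm E π = ranking E π (sigmaC (advice E π))

-- Let G = Ranking(id), let B₁ be the B-vertices left free by G (advice 1) and
-- B₂ the others (advice 2), and let M be any matching.  The proof has two parts.
--
-- Domination.  Running G and L side by side over the arrival order, every
-- B₂-vertex taken by L is already taken by G, and every A-vertex matched by G
-- is matched by L.  Hence |G| ≤ |L|.
--
-- Write |L| = y₁ + y₂ according to whether the L-partner lies in B₁
-- or B₂.  Ranking is greedy: if a is not matched to something at least as good
-- as b then b is taken.  Charging each edge (a, b) of M injectively to the
-- A-vertex holding b in L or in G gives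
--     |M| ≤ |L| + y₂           and           |M| ≤ |G| + 2·y₁,
-- so 3|M| ≤ 2(|L| + y₂) + |G| + 2y₁ ≤ 2|L| + |L| + 2(y₁ + y₂) ≤ 5|L|.
module Submission where

open import Defs
open import Data.Nat using (ℕ; zero; suc; _+_; _*_; _≤_; _<_; _<ᵇ_; _≡ᵇ_; s≤s; z≤n)
open import Data.Nat.Properties
open import Data.Nat.ListAction using (sum)
open import Data.Nat.Solver using (module +-*-Solver)
open import Data.Bool using (Bool; true; false; if_then_else_; _∧_; _∨_; not; T)
open import Data.Bool.Properties using (not-involutive)
open import Data.Empty using (⊥; ⊥-elim)
open import Data.Unit using (⊤; tt)
open import Data.Fin using (Fin; toℕ)
import Data.Fin as F
import Data.Fin.Properties as FP
open import Data.Fin.Permutation using (Permutation′; _⟨$⟩ʳ_; _⟨$⟩ˡ_; inverseʳ)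
open import Data.Maybe using (Maybe; just; nothing; is-just)
open import Data.Product using (∃; _×_; _,_; proj₁; proj₂)
open import Data.Sum using (_⊎_; inj₁; inj₂)
open import Data.List using (List; []; _∷_; foldl; allFin; tabulate; map)
open import Data.List.Properties using (map-tabulate)
open import Data.List.Membership.Propositional using (_∈_)
open import Data.List.Membership.Propositional.Properties using (∈-allFin; ∈-map⁺)
open import Data.List.Relation.Unary.Any using (here; there; satisfied)
open import Data.List.Relation.Unary.Any.Properties using (any⁺; any⁻)
import Data.List.Relation.Unary.All as All
open import Data.List.Relation.Unary.All.Properties using (¬Any⇒All¬)
open import Data.List.Relation.Unary.AllPairs using (_∷_)
open import Data.List.Relation.Unary.Unique.Propositional using (Unique)
import Data.List.Relation.Unary.Unique.Propositional.Properties as Unique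
open import Function using (id; _∘′_)
open import Function.Bundles using (Injection)
open import Function.Properties.Inverse using (↔⇒↣)
open import Relation.Binary.PropositionalEquality
open import Relation.Nullary using (does; yes; no)

∧-true : ∀ {x y} → x ∧ y ≡ true → x ≡ true × y ≡ true
∧-true {true} {true} _ = refl , refl

∧-not-true : ∀ {x y} → x ∧ not y ≡ true → x ≡ true × y ≡ false
∧-not-true {true} {false} _ = refl , refl

∧-not-intro : ∀ {x y} → x ≡ true → y ≡ false → x ∧ not y ≡ true
∧-not-intro refl refl = refl

∧-not-false : ∀ {x y} → x ∧ not y ≡ false → x ≡ true → y ≡ true
∧-not-false {true} {true} _ _ = refl

true≢false : true ≢ false
true≢false ()

T⇒≡true : ∀ {p} → T p → p ≡ true
T⇒≡true {true} _ = refl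

≡true⇒T : ∀ {p} → p ≡ true → T p
≡true⇒T refl = tt

≟-self : ∀ {k} (j : Fin k) → does (j F.≟ j) ≡ true
≟-self j with j F.≟ j
... | yes _ = refl
... | no j≢j = ⊥-elim (j≢j refl)

≟-other : ∀ {k} {i j : Fin k} → i ≢ j → does (i F.≟ j) ≡ false
≟-other {i = i} {j} i≢j with i F.≟ j
... | yes i≡j = ⊥-elim (i≢j i≡j)
... | no _ = refl

-- Counting the elements of Fin n satisfying a boolean predicate.  On suc n it
-- unfolds definitionally to  bit (P zero) + count (P ∘ suc).

bit : Bool → ℕ
bit b = if b then 1 else 0

count : ∀ {n} → (Fin n → Bool) → ℕ
count P = sum (tabulate (λ i → bit (P i)))

size≡count : ∀ {n m} (M : Assignment n m) → size M ≡ count (λ a → is-just (M a))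
size≡count M = cong sum (map-tabulate id (λ a → bit (is-just (M a))))

count-mono : ∀ {n} (P Q : Fin n → Bool) → (∀ i → P i ≡ true → Q i ≡ true) → count P ≤ count Q
count-mono {zero} P Q P⇒Q = z≤n
count-mono {suc n} P Q P⇒Q =
  +-mono-≤ (bit-mono (P F.zero) (Q F.zero) (P⇒Q F.zero))
           (count-mono (λ i → P (F.suc i)) (λ i → Q (F.suc i)) (λ i → P⇒Q (F.suc i)))
  where
  bit-mono : ∀ p q → (p ≡ true → q ≡ true) → bit p ≤ bit q
  bit-mono false q _ = z≤n
  bit-mono true q p⇒q rewrite p⇒q refl = ≤-refl

count-split : ∀ {n} (P Q : Fin n → Bool) →
              count P ≡ count (λ i → P i ∧ Q i) + count (λ i → P i ∧ not (Q i))
count-split {zero} P Q = refl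
count-split {suc n} P Q =
  trans (cong (bit (P F.zero) +_) (count-split (λ i → P (F.suc i)) (λ i → Q (F.suc i))))
        (bit-split (P F.zero) (Q F.zero) _ _)
  where
  bit-split : ∀ p q x y → bit p + (x + y) ≡ (bit (p ∧ q) + x) + (bit (p ∧ not q) + y)
  bit-split false q x y = refl
  bit-split true false x y = sym (+-suc x y)
  bit-split true true x y = refl

count-pos : ∀ {n} (P : Fin n → Bool) j → P j ≡ true → 1 ≤ count P
count-pos P F.zero Pj rewrite Pj = s≤s z≤n
count-pos P (F.suc j) Pj = ≤-trans (count-pos (λ i → P (F.suc i)) j Pj) (m≤n+m _ (bit (P F.zero)))

count-remove : ∀ {n} (Q : Fin n → Bool) j → Q j ≡ true →
               suc (count (λ i → Q i ∧ not (does (i F.≟ j)))) ≤ count Q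
count-remove Q j Qj = begin
  suc (count Q′)                                  ≤⟨ +-monoˡ-≤ (count Q′) (count-pos _ j Qj∧j≡j) ⟩
  count (λ i → Q i ∧ does (i F.≟ j)) + count Q′   ≡⟨ sym (count-split Q (λ i → does (i F.≟ j))) ⟩
  count Q                                         ∎
  where
  open ≤-Reasoning
  Q′ : _ → Bool
  Q′ i = Q i ∧ not (does (i F.≟ j))
  Qj∧j≡j : Q j ∧ does (j F.≟ j) ≡ true
  Qj∧j≡j rewrite Qj | ≟-self j = refl

count-inj : ∀ {n k} (P : Fin n → Bool) (Q : Fin k → Bool) (R : Fin n → Fin k → Set) →
            (∀ {i i′ j} → R i j → R i′ j → i ≡ i′) →
            (∀ i → P i ≡ true → ∃ λ j → Q j ≡ true × R i j) → count P ≤ count Q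
count-inj {zero} P Q R R-inj charge = z≤n
count-inj {suc n} P Q R R-inj charge with P F.zero in P0
... | false = count-inj (λ i → P (F.suc i)) Q (λ i → R (F.suc i))
                        (λ r r′ → FP.suc-injective (R-inj r r′)) (λ i → charge (F.suc i))
... | true with charge F.zero P0
... | j₀ , Qj₀ , Rj₀ = ≤-trans (s≤s rest) (count-remove Q j₀ Qj₀)
  where
  rest : count (λ i → P (F.suc i)) ≤ count (λ j → Q j ∧ not (does (j F.≟ j₀)))
  rest = count-inj (λ i → P (F.suc i)) _ (λ i → R (F.suc i))
                   (λ r r′ → FP.suc-injective (R-inj r r′)) charge′
    where
    charge′ : ∀ i → P (F.suc i) ≡ true → ∃ λ j → Q j ∧ not (does (j F.≟ j₀)) ≡ true × R (F.suc i) j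
    charge′ i Pi with charge (F.suc i) Pi
    ... | j , Qj , Rij with j F.≟ j₀
    ... | yes refl with () ← R-inj Rij Rj₀
    ... | no j≢j₀ = j , ∧-not-intro Qj (≟-other j≢j₀) , Rij

count-strict : ∀ {n} (P Q : Fin n → Bool) j → (∀ i → P i ≡ true → Q i ≡ true) →
               P j ≡ false → Q j ≡ true → count P < count Q
count-strict P Q j P⇒Q Pj Qj = begin-strict
  count P                                       ≤⟨ count-mono P (λ i → Q i ∧ P i) P⇒Q∧P ⟩
  count (λ i → Q i ∧ P i)                       <⟨ m<m+n _ (count-pos _ j (∧-not-intro Qj Pj)) ⟩
  count (λ i → Q i ∧ P i) + count (λ i → Q i ∧ not (P i)) ≡⟨ sym (count-split Q P) ⟩
  count Q                                       ∎
  where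
  open ≤-Reasoning
  P⇒Q∧P : ∀ i → P i ≡ true → Q i ∧ P i ≡ true
  P⇒Q∧P i Pi rewrite P⇒Q i Pi = Pi

module _ {m : ℕ} (σ : Fin m → ℕ) (ok : Fin m → Bool) where

  Best : (Fin m → Set) → Maybe (Fin m) → Set
  Best S nothing = ∀ b → S b → ok b ≡ false
  Best S (just b) = ok b ≡ true × (∀ b′ → S b′ → ok b′ ≡ true → σ b ≤ σ b′)

  best-weaken : ∀ {S S′ : Fin m → Set} r → (∀ b → S′ b → S b) → Best S r → Best S′ r
  best-weaken nothing S′⊆S best b s = best b (S′⊆S b s)
  best-weaken (just b) S′⊆S (okb , min) = okb , λ b′ s → min b′ (S′⊆S b′ s)

  -- The rule is passed with its two defining equations,
  -- since the step function of `pick` is local to its definition.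
  module Scan (step : Maybe (Fin m) → Fin m → Maybe (Fin m))
              (step-nothing : ∀ x → step nothing x ≡ (if ok x then just x else nothing))
              (step-just : ∀ b x → step (just b) x ≡ (if ok x ∧ (σ x <ᵇ σ b) then just x else just b))
              where

    scan-step : ∀ S x r → Best S r → Best (λ b → S b ⊎ b ≡ x) (step r x)
    scan-step S x nothing best rewrite step-nothing x with ok x in okx
    ... | true = okx , λ { b′ (inj₁ s) okb′ → ⊥-elim (true≢false (trans (sym okb′) (best b′ s)))
                         ; b′ (inj₂ refl) _ → ≤-refl }
    ... | false = λ { b (inj₁ s) → best b s ; b (inj₂ refl) → okx }
    scan-step S x (just b) (okb , min) rewrite step-just b x with ok x in okx | σ x <ᵇ σ b in x<b
    ... | true | true = okx , λ { b′ (inj₁ s) okb′ → ≤-trans (<⇒≤ (<ᵇ⇒< _ _ (≡true⇒T x<b))) (min b′ s okb′)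
                                ; b′ (inj₂ refl) _ → ≤-refl }
    ... | true | false = okb , λ { b′ (inj₁ s) okb′ → min b′ s okb′
                                 ; b′ (inj₂ refl) _ → ≮⇒≥ (λ lt → true≢false (trans (sym (T⇒≡true (<⇒<ᵇ lt))) x<b)) }
    ... | false | _ = okb , λ { b′ (inj₁ s) okb′ → min b′ s okb′
                              ; b′ (inj₂ refl) okb′ → ⊥-elim (true≢false (trans (sym okb′) okx)) }

    scan : ∀ S xs r → Best S r → Best (λ b → S b ⊎ b ∈ xs) (foldl step r xs)
    scan S [] r best = best-weaken r (λ { b (inj₁ s) → s ; b (inj₂ ()) }) best
    scan S (x ∷ xs) r best =
      best-weaken (foldl step (step r x) xs) regroup (scan _ xs (step r x) (scan-step S x r best))
      where
      regroup : ∀ b → S b ⊎ b ∈ x ∷ xs → (S b ⊎ b ≡ x) ⊎ b ∈ xs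
      regroup b (inj₁ s) = inj₁ (inj₁ s)
      regroup b (inj₂ (here b≡x)) = inj₁ (inj₂ b≡x)
      regroup b (inj₂ (there b∈xs)) = inj₂ b∈xs

  pick-best : Best (λ _ → ⊤) (pick σ ok)
  pick-best = best-weaken (pick σ ok) (λ b _ → inj₂ (∈-allFin b))
    (Scan.scan _ (λ _ → refl) (λ _ _ → refl) (λ _ → ⊥) (allFin m) nothing (λ _ ()))

pick-nothing : ∀ {m} (σ : Fin m → ℕ) ok → pick σ ok ≡ nothing → ∀ b → ok b ≡ false
pick-nothing σ ok eq b with pick σ ok | pick-best σ ok
pick-nothing σ ok refl b | nothing | none = none b tt

pick-just : ∀ {m} (σ : Fin m → ℕ) ok {b} → pick σ ok ≡ just b →
            ok b ≡ true × (∀ b′ → ok b′ ≡ true → σ b ≤ σ b′)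
pick-just σ ok eq with pick σ ok | pick-best σ ok
pick-just σ ok refl | just b | okb , min = okb , λ b′ → min b′ tt

-- The advice ranking σ_c orders B lexicographically by (c b, b): σ_c b counts
-- the vertices strictly before b in that order, so it is strictly monotone.

module _ {m : ℕ} (c : Fin m → ℕ) where

  lexBefore : Fin m → Fin m → Bool
  lexBefore x y = (c x <ᵇ c y) ∨ ((c x ≡ᵇ c y) ∧ (toℕ x <ᵇ toℕ y))

  LexBefore : Fin m → Fin m → Set
  LexBefore x y = c x < c y ⊎ (c x ≡ c y × toℕ x < toℕ y)

  lexBefore-sound : ∀ x y → lexBefore x y ≡ true → LexBefore x y
  lexBefore-sound x y before with c x <ᵇ c y in cx<cy | c x ≡ᵇ c y in cx≡cy | toℕ x <ᵇ toℕ y in x<y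
  ... | true  | _     | _     = inj₁ (<ᵇ⇒< _ _ (≡true⇒T cx<cy))
  ... | false | true  | true  = inj₂ (≡ᵇ⇒≡ _ _ (≡true⇒T cx≡cy) , <ᵇ⇒< _ _ (≡true⇒T x<y))
  ... | false | true  | false with () ← before
  ... | false | false | _     with () ← before

  lexBefore-complete : ∀ x y → LexBefore x y → lexBefore x y ≡ true
  lexBefore-complete x y (inj₁ cx<cy) rewrite T⇒≡true (<⇒<ᵇ cx<cy) = refl
  lexBefore-complete x y (inj₂ (cx≡cy , x<y))
    rewrite T⇒≡true (≡⇒≡ᵇ _ _ cx≡cy) | T⇒≡true (<⇒<ᵇ x<y) with c x <ᵇ c y
  ... | true = refl
  ... | false = refl

  LexBefore-trans : ∀ {x y z} → LexBefore x y → LexBefore y z → LexBefore x z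
  LexBefore-trans (inj₁ xy) (inj₁ yz) = inj₁ (<-trans xy yz)
  LexBefore-trans (inj₁ xy) (inj₂ (yz , _)) = inj₁ (<-≤-trans xy (≤-reflexive yz))
  LexBefore-trans (inj₂ (xy , _)) (inj₁ yz) = inj₁ (≤-<-trans (≤-reflexive xy) yz)
  LexBefore-trans (inj₂ (xy , x<y)) (inj₂ (yz , y<z)) = inj₂ (trans xy yz , <-trans x<y y<z)

  lexBefore-irrefl : ∀ x → lexBefore x x ≡ false
  lexBefore-irrefl x with lexBefore x x in before
  ... | false = refl
  ... | true with lexBefore-sound x x before
  ... | inj₁ cx<cx = ⊥-elim (<-irrefl refl cx<cx)
  ... | inj₂ (_ , x<x) = ⊥-elim (<-irrefl refl x<x)

  sigmaC≡count : ∀ b → sigmaC c b ≡ count (λ b′ → lexBefore b′ b)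
  sigmaC≡count b = cong sum (map-tabulate id (λ b′ → bit (lexBefore b′ b)))

  sigmaC-mono : ∀ x y → LexBefore x y → sigmaC c x < sigmaC c y
  sigmaC-mono x y x<y rewrite sigmaC≡count x | sigmaC≡count y =
    count-strict _ _ x
      (λ z z<x → lexBefore-complete z y (LexBefore-trans (lexBefore-sound z x z<x) x<y))
      (lexBefore-irrefl x) (lexBefore-complete x y x<y)

-- One Ranking run.  A state records the partial assignment and the set of
-- taken B-vertices.  (`assign` and `occupy` are the updates of `rankingStep`.)

State : ℕ → ℕ → Set
State n m = Assignment n m × (Fin m → Bool)

start : ∀ {n m} → State n m
start = (λ _ → nothing) , (λ _ → false)

assign : ∀ {n m} → Assignment n m → Fin n → Fin m → Assignment n m
assign M a b a′ = if does (a′ F.≟ a) then just b else M a′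

occupy : ∀ {m} → (Fin m → Bool) → Fin m → Fin m → Bool
occupy U b b′ = if does (b′ F.≟ b) then true else U b′

assign-self : ∀ {n m} (M : Assignment n m) a b → assign M a b a ≡ just b
assign-self M a b rewrite ≟-self a = refl

assign-other : ∀ {n m} (M : Assignment n m) {a} b {a′} → a′ ≢ a → assign M a b a′ ≡ M a′
assign-other M b a′≢a rewrite ≟-other a′≢a = refl

occupy-self : ∀ {m} (U : Fin m → Bool) b → occupy U b b ≡ true
occupy-self U b rewrite ≟-self b = refl

occupy-mono : ∀ {m} (U : Fin m → Bool) b {b′} → U b′ ≡ true → occupy U b b′ ≡ true
occupy-mono U b {b′} taken with b′ F.≟ b
... | yes _ = refl
... | no _ = taken

occupy-cases : ∀ {m} (U : Fin m → Bool) b {b′} → occupy U b b′ ≡ true → b′ ≡ b ⊎ U b′ ≡ true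
occupy-cases U b {b′} taken with b′ F.≟ b
... | yes b′≡b = inj₁ b′≡b
... | no _ = inj₂ taken

assign-keeps : ∀ {n m} (M : Assignment n m) a₀ b a → is-just (M a) ≡ true → is-just (assign M a₀ b a) ≡ true
assign-keeps M a₀ b a matched with a F.≟ a₀
... | yes _ = refl
... | no _ = matched

data StepView {n m} (E : Graph n m) (σ : Fin m → ℕ) (M : Assignment n m)
              (U : Fin m → Bool) (a : Fin n) : State n m → Set where
  no-choice : pick σ (λ b → E a b ∧ not (U b)) ≡ nothing → StepView E σ M U a (M , U)
  choice : ∀ b → pick σ (λ b → E a b ∧ not (U b)) ≡ just b →
           StepView E σ M U a (assign M a b , occupy U b)

step-view : ∀ {n m} (E : Graph n m) σ M U a → StepView E σ M U a (rankingStep E σ (M , U) a)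
step-view E σ M U a with pick σ (λ b → E a b ∧ not (U b)) in chosen
... | nothing = no-choice chosen
... | just b = choice b chosen

chosen-free-nbr : ∀ {n m} (E : Graph n m) σ (U : Fin m → Bool) a {b} →
                  pick σ (λ b → E a b ∧ not (U b)) ≡ just b → E a b ≡ true × U b ≡ false
chosen-free-nbr E σ U a chosen = ∧-not-true (proj₁ (pick-just σ _ chosen))

foldl-invariant : ∀ {A S : Set} (f : S → A → S) (I : List A → S → Set) →
                  (∀ x xs s → I (x ∷ xs) s → I xs (f s x)) →
                  ∀ xs s → I xs s → I [] (foldl f s xs)
foldl-invariant f I step [] s i = i
foldl-invariant f I step (x ∷ xs) s i = foldl-invariant f I step xs (f s x) (step x xs s i)

foldl-invariant₂ : ∀ {A S₁ S₂ : Set} (f : S₁ → A → S₁) (g : S₂ → A → S₂) (I : List A → S₁ → S₂ → Set) →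
                   (∀ x xs s₁ s₂ → I (x ∷ xs) s₁ s₂ → I xs (f s₁ x) (g s₂ x)) →
                   ∀ xs s₁ s₂ → I xs s₁ s₂ → I [] (foldl f s₁ xs) (foldl g s₂ xs)
foldl-invariant₂ f g I step [] s₁ s₂ i = i
foldl-invariant₂ f g I step (x ∷ xs) s₁ s₂ i = foldl-invariant₂ f g I step xs (f s₁ x) (g s₂ x) (step x xs s₁ s₂ i)

module Run {n m : ℕ} (E : Graph n m) (σ : Fin m → ℕ) where

  Settled : State n m → Fin n → Set
  Settled s a = ∀ b → E a b ≡ true → (∃ λ b′ → proj₁ s a ≡ just b′ × σ b′ ≤ σ b) ⊎ proj₂ s b ≡ true

  record Invariant (pending : List (Fin n)) (s : State n m) : Set where
    field
      taken⇒assigned : ∀ b → proj₂ s b ≡ true → ∃ λ a → proj₁ s a ≡ just b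
      pending-free : ∀ a → a ∈ pending → proj₁ s a ≡ nothing
      pending-unique : Unique pending
      pending-or-settled : ∀ a → a ∈ pending ⊎ Settled s a

  settled-mono : ∀ s s′ a → proj₁ s′ a ≡ proj₁ s a → (∀ b → proj₂ s b ≡ true → proj₂ s′ b ≡ true) →
                 Settled s a → Settled s′ a
  settled-mono s s′ a same grow settled b e with settled b e
  ... | inj₁ (b′ , Ma , better) = inj₁ (b′ , trans same Ma , better)
  ... | inj₂ taken = inj₂ (grow b taken)

  settled-now : ∀ M U a s → StepView E σ M U a s → Settled s a
  settled-now M U a _ (no-choice none) b e = inj₂ (∧-not-false (pick-nothing σ _ none b) e)
  settled-now M U a _ (choice b chosen) b₂ e with E a b₂ ∧ not (U b₂) in free
  ... | true = inj₁ (b , assign-self M a b , proj₂ (pick-just σ _ chosen) b₂ free)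
  ... | false = inj₂ (occupy-mono U b (∧-not-false free e))

  invariant-step : ∀ a₀ rest s → Invariant (a₀ ∷ rest) s → Invariant rest (rankingStep E σ s a₀)
  invariant-step a₀ rest (M , U) inv with rankingStep E σ (M , U) a₀ | step-view E σ M U a₀
  ... | s′ | view = record
    { taken⇒assigned = taken⇒assigned′ view
    ; pending-free = λ a a∈rest → trans (kept view (a₀∉rest a∈rest)) (pending-free a (there a∈rest))
    ; pending-unique = rest-unique
    ; pending-or-settled = settled′
    }
    where
    open Invariant inv
    a₀∉rest : ∀ {a} → a ∈ rest → a ≢ a₀
    a₀∉rest a∈rest a≡a₀ with pending-unique
    ... | a₀∉ ∷ _ = All.lookup a₀∉ a∈rest (sym a≡a₀)
    rest-unique : Unique rest
    rest-unique with pending-unique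
    ... | _ ∷ unique = unique
    kept : ∀ {s′ a} → StepView E σ M U a₀ s′ → a ≢ a₀ → proj₁ s′ a ≡ M a
    kept (no-choice _) _ = refl
    kept (choice b _) a≢a₀ = assign-other M b a≢a₀
    grows : ∀ {s′} → StepView E σ M U a₀ s′ → ∀ b → U b ≡ true → proj₂ s′ b ≡ true
    grows (no-choice _) b taken = taken
    grows (choice b′ _) b taken = occupy-mono U b′ taken
    taken⇒assigned′ : ∀ {s′} → StepView E σ M U a₀ s′ → ∀ b → proj₂ s′ b ≡ true → ∃ λ a → proj₁ s′ a ≡ just b
    taken⇒assigned′ (no-choice _) = taken⇒assigned
    taken⇒assigned′ (choice b _) b′ taken with occupy-cases U b taken
    ... | inj₁ refl = a₀ , assign-self M a₀ b
    ... | inj₂ taken-before with taken⇒assigned b′ taken-before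
    ... | a , Ma with a F.≟ a₀
    ... | yes refl with () ← trans (sym Ma) (pending-free a₀ (here refl))
    ... | no a≢a₀ = a , trans (assign-other M b a≢a₀) Ma
    settled′ : ∀ a → a ∈ rest ⊎ Settled s′ a
    settled′ a with a F.≟ a₀ | pending-or-settled a
    ... | yes refl | _ = inj₂ (settled-now M U a₀ s′ view)
    ... | no a≢a₀ | inj₁ (here a≡a₀) = ⊥-elim (a≢a₀ a≡a₀)
    ... | no _ | inj₁ (there a∈rest) = inj₁ a∈rest
    ... | no a≢a₀ | inj₂ settled = inj₂ (settled-mono (M , U) s′ a (kept view a≢a₀) (grows view) settled)

  taken-persists : ∀ xs s b → proj₂ s b ≡ true → proj₂ (foldl (rankingStep E σ) s xs) b ≡ true
  taken-persists [] s b taken = taken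
  taken-persists (x ∷ xs) (M , U) b taken with rankingStep E σ (M , U) x | step-view E σ M U x
  ... | _ | no-choice _ = taken-persists xs (M , U) b taken
  ... | _ | choice b′ _ = taken-persists xs (assign M x b′ , occupy U b′) b (occupy-mono U b′ taken)

arrivals : ∀ {n} → Permutation′ n → List (Fin n)
arrivals {n} π = map (π ⟨$⟩ʳ_) (allFin n)

arrivals-unique : ∀ {n} (π : Permutation′ n) → Unique (arrivals π)
arrivals-unique π = Unique.map⁺ (Injection.injective (↔⇒↣ π)) (Unique.allFin⁺ _)

arrivals-complete : ∀ {n} (π : Permutation′ n) a → a ∈ arrivals π
arrivals-complete π a = subst (_∈ arrivals π) (inverseʳ π) (∈-map⁺ (π ⟨$⟩ʳ_) (∈-allFin (π ⟨$⟩ˡ a)))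

-- The final state; its assignment is `ranking E π σ` by definition.
finalState : ∀ {n m} → Graph n m → Permutation′ n → (Fin m → ℕ) → State n m
finalState E π σ = foldl (rankingStep E σ) start (arrivals π)

module _ {n m : ℕ} (E : Graph n m) (π : Permutation′ n) (σ : Fin m → ℕ) where
  open Run E σ

  final-invariant : Invariant [] (finalState E π σ)
  final-invariant = foldl-invariant (rankingStep E σ) Invariant invariant-step (arrivals π) start record
    { taken⇒assigned = λ _ ()
    ; pending-free = λ _ _ → refl
    ; pending-unique = arrivals-unique π
    ; pending-or-settled = λ a → inj₁ (arrivals-complete π a)
    }

  taken⇒matched : ∀ b → proj₂ (finalState E π σ) b ≡ true → ∃ λ a → ranking E π σ a ≡ just b
  taken⇒matched = Invariant.taken⇒assigned final-invariant

  greedy : ∀ a b → E a b ≡ true →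
           (∃ λ b′ → ranking E π σ a ≡ just b′ × σ b′ ≤ σ b) ⊎ (∃ λ a′ → ranking E π σ a′ ≡ just b)
  greedy a b e with Invariant.pending-or-settled final-invariant a
  ... | inj₂ settled with settled b e
  ... | inj₁ better = inj₁ better
  ... | inj₂ taken = inj₂ (taken⇒matched b taken)

-- `matchedB G b` holds exactly when some A-vertex is assigned to b.  Its
-- membership test is local to its definition, so it is reached only through
-- the generic lemmas any⁺ and any⁻ about `any`.

matched-intro : ∀ {n m} (G : Assignment n m) a b → G a ≡ just b → matchedB G b ≡ true
matched-intro {n} G a b Ga with matchedB G b in unmatched
... | true = refl
... | false with All.lookup (¬Any⇒All¬ (allFin n) (λ p → subst T unmatched (any⁺ _ p))) (∈-allFin a)
... | not-b rewrite Ga with b F.≟ b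
... | yes _ = ⊥-elim (not-b tt)
... | no b≢b = ⊥-elim (b≢b refl)

matched-elim : ∀ {n m} (G : Assignment n m) b → matchedB G b ≡ true → ∃ λ a → G a ≡ just b
matched-elim {n} G b matched with satisfied (any⁻ _ (allFin n) (≡true⇒T matched))
... | a , is-b with G a in Ga
... | just b′ with b′ F.≟ b
... | yes refl = a , Ga
matched-elim G b matched | a , () | just b′ | no _
matched-elim G b matched | a , () | nothing

module Domination {n m : ℕ} (E : Graph n m) (π : Permutation′ n) where

  c : Fin m → ℕ
  c = advice E π

  σc : Fin m → ℕ
  σc = sigmaC c

  stepG stepL : State n m → Fin n → State n m
  stepG = rankingStep E idRank
  stepL = rankingStep E σc

  record Dominates (rest : List (Fin n)) (sG sL : State n m) : Set where
    field
      G-completes : foldl stepG sG rest ≡ finalState E π idRank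
      B₂-taken : ∀ b → proj₂ sL b ≡ true → c b ≡ 2 → proj₂ sG b ≡ true
      matched-dominated : ∀ a → is-just (proj₁ sG a) ≡ true → is-just (proj₁ sL a) ≡ true

  takenG⇒B₂ : ∀ sG rest b → foldl stepG sG rest ≡ finalState E π idRank → proj₂ sG b ≡ true → c b ≡ 2
  takenG⇒B₂ sG rest b completes taken
    with taken⇒matched E π idRank b (subst (λ s → proj₂ s b ≡ true) completes (Run.taken-persists E idRank rest sG b taken))
  ... | a , Ga rewrite matched-intro (ranking E π idRank) a b Ga = refl

  G-choice-free-in-L : ∀ {UG UL : Fin m → Bool} a₀ bG → pick idRank (λ b → E a₀ b ∧ not (UG b)) ≡ just bG →
                       (∀ b → UL b ≡ true → c b ≡ 2 → UG b ≡ true) → c bG ≡ 2 → UL bG ≡ false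
  G-choice-free-in-L {UG} {UL} a₀ bG chosen B₂-taken cbG with UL bG in takenL
  ... | false = refl
  ... | true with () ← trans (sym (B₂-taken bG takenL cbG)) (proj₂ (chosen-free-nbr E idRank UG a₀ chosen))

  -- If both runs choose and L's choice has advice 2 but is free in G, the
  -- choices agree: among advice-2 vertices σ_c and the identity rank agree.
  same-choice : ∀ {UG UL : Fin m → Bool} a₀ {bG bL} →
                pick idRank (λ b → E a₀ b ∧ not (UG b)) ≡ just bG →
                pick σc (λ b → E a₀ b ∧ not (UL b)) ≡ just bL →
                UL bG ≡ false → c bG ≡ 2 → UG bL ≡ false → c bL ≡ 2 → bL ≡ bG
  same-choice {UG} {UL} a₀ {bG} {bL} chosenG chosenL freeL-bG cbG freeG-bL cbL =
    FP.toℕ-injective (≤-antisym bL≤bG bG≤bL)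
    where
    bG≤bL : toℕ bG ≤ toℕ bL
    bG≤bL = proj₂ (pick-just idRank _ chosenG) bL
              (∧-not-intro (proj₁ (chosen-free-nbr E σc UL a₀ chosenL)) freeG-bL)
    σbL≤σbG : σc bL ≤ σc bG
    σbL≤σbG = proj₂ (pick-just σc _ chosenL) bG
                (∧-not-intro (proj₁ (chosen-free-nbr E idRank UG a₀ chosenG)) freeL-bG)
    bL≤bG : toℕ bL ≤ toℕ bG
    bL≤bG = ≮⇒≥ (λ bG<bL → <⇒≱ (sigmaC-mono c bG bL (inj₂ (trans cbG (sym cbL) , bG<bL))) σbL≤σbG)

  dominates-cases : ∀ {MG UG ML UL a₀ rest sG′ sL′} →
    StepView E idRank MG UG a₀ sG′ → StepView E σc ML UL a₀ sL′ →
    foldl stepG sG′ rest ≡ finalState E π idRank →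
    (∀ b → UL b ≡ true → c b ≡ 2 → UG b ≡ true) →
    (∀ a → is-just (MG a) ≡ true → is-just (ML a) ≡ true) →
    Dominates rest sG′ sL′
  dominates-cases (no-choice _) (no-choice _) completes B₂-taken dominated =
    record { G-completes = completes ; B₂-taken = B₂-taken ; matched-dominated = dominated }
  dominates-cases {MG} {UG} {ML} {UL} {a₀} (no-choice noneG) (choice bL chosenL) completes B₂-taken dominated =
    record { G-completes = completes ; B₂-taken = B₂-taken′ ; matched-dominated = λ a → assign-keeps ML a₀ bL a ∘′ dominated a }
    where
    B₂-taken′ : ∀ b → occupy UL bL b ≡ true → c b ≡ 2 → UG b ≡ true
    B₂-taken′ b takenL cb with occupy-cases UL bL takenL
    ... | inj₁ refl = ∧-not-false (pick-nothing idRank _ noneG b) (proj₁ (chosen-free-nbr E σc UL a₀ chosenL))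
    ... | inj₂ takenL-before = B₂-taken b takenL-before cb
  dominates-cases {MG} {UG} {ML} {UL} {a₀} {rest} (choice bG chosenG) (no-choice noneL) completes B₂-taken dominated =
    ⊥-elim (true≢false (trans (sym bG-free-nbr) (pick-nothing σc _ noneL bG)))
    where
    bG-free-nbr : E a₀ bG ∧ not (UL bG) ≡ true
    bG-free-nbr = ∧-not-intro (proj₁ (chosen-free-nbr E idRank UG a₀ chosenG))
                    (G-choice-free-in-L a₀ bG chosenG B₂-taken (takenG⇒B₂ _ rest bG completes (occupy-self UG bG)))
  dominates-cases {MG} {UG} {ML} {UL} {a₀} {rest} (choice bG chosenG) (choice bL chosenL) completes B₂-taken dominated =
    record { G-completes = completes ; B₂-taken = B₂-taken′ ; matched-dominated = dominated′ }
    where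
    cbG : c bG ≡ 2
    cbG = takenG⇒B₂ _ rest bG completes (occupy-self UG bG)
    B₂-taken′ : ∀ b → occupy UL bL b ≡ true → c b ≡ 2 → occupy UG bG b ≡ true
    B₂-taken′ b takenL cb with occupy-cases UL bL takenL
    ... | inj₂ takenL-before = occupy-mono UG bG (B₂-taken b takenL-before cb)
    ... | inj₁ refl = by-G-status (UG bL) refl
      where
      by-G-status : ∀ x → UG bL ≡ x → occupy UG bG bL ≡ true
      by-G-status true takenG = occupy-mono UG bG takenG
      by-G-status false freeG
        rewrite same-choice a₀ chosenG chosenL (G-choice-free-in-L a₀ bG chosenG B₂-taken cbG) cbG freeG cb =
        occupy-self UG bG
    dominated′ : ∀ a → is-just (assign MG a₀ bG a) ≡ true → is-just (assign ML a₀ bL a) ≡ true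
    dominated′ a matched with a F.≟ a₀
    ... | yes _ = refl
    ... | no _ = dominated a matched

  dominates-step : ∀ a₀ rest sG sL → Dominates (a₀ ∷ rest) sG sL → Dominates rest (stepG sG a₀) (stepL sL a₀)
  dominates-step a₀ rest (MG , UG) (ML , UL) D =
    dominates-cases (step-view E idRank MG UG a₀) (step-view E σc ML UL a₀)
                    G-completes B₂-taken matched-dominated
    where open Dominates D

  G-matched⇒L-matched : ∀ a → is-just (ranking E π idRank a) ≡ true → is-just (algorithm E π a) ≡ true
  G-matched⇒L-matched = Dominates.matched-dominated
    (foldl-invariant₂ stepG stepL Dominates dominates-step (arrivals π) start start
      record { G-completes = refl ; B₂-taken = λ _ () ; matched-dominated = λ _ () })

module Bounds {n m : ℕ} (E : Graph n m) (π : Permutation′ n) (M : Assignment n m) (M-matching : IsMatching E M) where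

  open Domination E π using (σc; G-matched⇒L-matched)

  G L : Assignment n m
  G = ranking E π idRank
  L = algorithm E π

  inB₁ : Maybe (Fin m) → Bool
  inB₁ nothing = false
  inB₁ (just b) = not (matchedB G b)

  opt |G| |L| y₁ y₂ : ℕ
  opt = count (λ a → is-just (M a))
  |G| = count (λ a → is-just (G a))
  |L| = count (λ a → is-just (L a))
  y₁ = count (λ a → inB₁ (L a))
  y₂ = count (λ a → is-just (L a) ∧ not (inB₁ (L a)))

  SharesPartner : Assignment n m → Fin n → Fin n → Set
  SharesPartner N a j = ∃ λ b → M a ≡ just b × N j ≡ just b

  sharesPartner-inj : ∀ N {a a′ j} → SharesPartner N a j → SharesPartner N a′ j → a ≡ a′
  sharesPartner-inj N (b , Ma , Nj) (b′ , Ma′ , Nj′) with trans (sym Nj) Nj′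
  ... | refl = proj₂ M-matching _ _ b Ma Ma′

  |G|≤|L| : |G| ≤ |L|
  |G|≤|L| = count-mono _ _ (G-matched⇒L-matched)

  y₁+y₂≤|L| : y₁ + y₂ ≤ |L|
  y₁+y₂≤|L| = begin
    y₁ + y₂                                                   ≤⟨ +-monoˡ-≤ y₂ (count-mono _ _ (λ a → matched-in-B₁ (L a))) ⟩
    count (λ a → is-just (L a) ∧ inB₁ (L a)) + y₂             ≡⟨ sym (count-split _ (λ a → inB₁ (L a))) ⟩
    |L|                                                       ∎
    where
    open ≤-Reasoning
    matched-in-B₁ : ∀ x → inB₁ x ≡ true → is-just x ∧ inB₁ x ≡ true
    matched-in-B₁ (just b) inB₁b = inB₁b

  G-unmatched⇒nbrs-in-B₂ : ∀ a b → E a b ≡ true → G a ≡ nothing → matchedB G b ≡ true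
  G-unmatched⇒nbrs-in-B₂ a b e Ga with greedy E π idRank a b e
  ... | inj₁ (_ , Ga′ , _) with () ← trans (sym Ga) Ga′
  ... | inj₂ (a′ , Ga′) = matched-intro G a′ b Ga′

  L-unmatched⇒G-unmatched : ∀ a → L a ≡ nothing → G a ≡ nothing
  L-unmatched⇒G-unmatched a La with G a in Ga
  ... | nothing = refl
  ... | just _ with () ← trans (sym (cong is-just La)) (G-matched⇒L-matched a (cong is-just Ga))

  -- |M| ≤ |L| + y₂: an M-edge (a, b) with a unmatched in L is charged to the
  -- L-holder of b, which lies in B₂ because a is unmatched in G as well.
  opt≤|L|+y₂ : opt ≤ |L| + y₂
  opt≤|L|+y₂ = begin
    opt                                                  ≡⟨ count-split _ (λ a → is-just (L a)) ⟩
    count (λ a → is-just (M a) ∧ is-just (L a))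
      + count (λ a → is-just (M a) ∧ not (is-just (L a))) ≤⟨ +-mono-≤ (count-mono _ (λ a → is-just (L a)) (λ a → proj₂ ∘′ ∧-true {is-just (M a)}))
                                                                        (count-inj _ _ (SharesPartner L) (sharesPartner-inj L) charge) ⟩
    |L| + y₂                                             ∎
    where
    open ≤-Reasoning
    charge : ∀ a → is-just (M a) ∧ not (is-just (L a)) ≡ true →
             ∃ λ j → is-just (L j) ∧ not (inB₁ (L j)) ≡ true × SharesPartner L a j
    charge a unmatchedL with M a in Ma | L a in La
    charge a () | nothing | _
    charge a () | just b | just _
    charge a _ | just b | nothing with greedy E π σc a b (proj₁ M-matching a b Ma)
    ... | inj₁ (_ , La′ , _) with () ← trans (sym La) La′
    ... | inj₂ (a″ , La″) = a″ , in-B₂ , b , refl , La″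
      where
      in-B₂ : is-just (L a″) ∧ not (inB₁ (L a″)) ≡ true
      in-B₂ rewrite La″ | G-unmatched⇒nbrs-in-B₂ a b (proj₁ M-matching a b Ma) (L-unmatched⇒G-unmatched a La) = refl

  B₁-before-B₂ : ∀ b b′ → matchedB G b ≡ false → matchedB G b′ ≡ true →
                 σc b < σc b′
  B₁-before-B₂ b b′ b∈B₁ b′∈B₂ = sigmaC-mono (advice E π) b b′ (inj₁ advice<)
    where
    advice< : advice E π b < advice E π b′
    advice< rewrite b∈B₁ | b′∈B₂ = s≤s (s≤s z≤n)

  -- |M| ≤ |G| + 2·y₁: an M-edge (a, b) with b ∈ B₂ is charged to the G-holder
  -- of b; one with b ∈ B₁ is charged either to a itself, when L matches a into
  -- B₁, or else to the L-holder of b, which exists because L prefers b to any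
  -- vertex of B₂.
  opt≤|G|+2y₁ : opt ≤ |G| + (y₁ + y₁)
  opt≤|G|+2y₁ = begin
    opt                                    ≡⟨ count-split _ (λ a → inB₁ (M a)) ⟩
    count P + count Q                      ≡⟨ cong (_+ count Q) (count-split P (λ a → inB₁ (L a))) ⟩
    (count (λ a → P a ∧ inB₁ (L a)) + count (λ a → P a ∧ not (inB₁ (L a)))) + count Q
                                           ≤⟨ +-mono-≤ (+-mono-≤ (count-mono _ (λ a → inB₁ (L a)) (λ a → proj₂ ∘′ ∧-true {P a}))
                                                                 (count-inj _ _ (SharesPartner L) (sharesPartner-inj L) charge-B₁))
                                                       (count-inj _ _ (SharesPartner G) (sharesPartner-inj G) charge-B₂) ⟩
    (y₁ + y₁) + |G|                        ≡⟨ +-comm (y₁ + y₁) |G| ⟩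
    |G| + (y₁ + y₁)                        ∎
    where
    open ≤-Reasoning
    P Q : Fin n → Bool
    P a = is-just (M a) ∧ inB₁ (M a)
    Q a = is-just (M a) ∧ not (inB₁ (M a))

    charge-B₂ : ∀ a → Q a ≡ true → ∃ λ j → is-just (G j) ≡ true × SharesPartner G a j
    charge-B₂ a Qa with M a in Ma
    charge-B₂ a () | nothing
    ... | just b with matchedB G b in b∈B₂
    charge-B₂ a () | just b | false
    ... | true with matched-elim G b b∈B₂
    ... | a′ , Ga′ = a′ , cong is-just Ga′ , b , refl , Ga′

    charge-B₁ : ∀ a → P a ∧ not (inB₁ (L a)) ≡ true → ∃ λ j → inB₁ (L j) ≡ true × SharesPartner L a j
    charge-B₁ a PLa with M a in Ma
    charge-B₁ a () | nothing
    ... | just b with matchedB G b in b∈B₁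
    charge-B₁ a () | just b | true
    ... | false with greedy E π σc a b (proj₁ M-matching a b Ma)
    ... | inj₂ (a″ , La″) = a″ , subst (λ x → inB₁ x ≡ true) (sym La″) (cong not b∈B₁) , b , refl , La″
    ... | inj₁ (b′ , La′ , σb′≤σb) = ⊥-elim (<⇒≱ (B₁-before-B₂ b b′ b∈B₁ b′∈B₂) σb′≤σb)
      where
      b′∈B₂ : matchedB G b′ ≡ true
      b′∈B₂ = trans (sym (not-involutive _)) (subst (λ x → not (inB₁ x) ≡ true) La′ PLa)

three-fifths : ∀ opt x y y₁ y₂ → opt ≤ y + y₂ → opt ≤ x + (y₁ + y₁) → x ≤ y → y₁ + y₂ ≤ y → 3 * opt ≤ 5 * y
three-fifths opt x y y₁ y₂ opt≤y+y₂ opt≤x+2y₁ x≤y y₁+y₂≤y = begin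
  opt + (opt + (opt + 0))                       ≤⟨ +-mono-≤ opt≤y+y₂ (+-mono-≤ opt≤y+y₂ (+-monoˡ-≤ 0 opt≤x+2y₁)) ⟩
  (y + y₂) + ((y + y₂) + ((x + (y₁ + y₁)) + 0)) ≡⟨ regroup y y₂ x y₁ ⟩
  (y + y) + (x + ((y₁ + y₂) + (y₁ + y₂)))       ≤⟨ +-monoʳ-≤ (y + y) (+-mono-≤ x≤y (+-mono-≤ y₁+y₂≤y y₁+y₂≤y)) ⟩
  (y + y) + (y + (y + y))                       ≡⟨ five y ⟩
  5 * y                                         ∎
  where
  open ≤-Reasoning
  open +-*-Solver
  regroup : ∀ y y₂ x y₁ → (y + y₂) + ((y + y₂) + ((x + (y₁ + y₁)) + 0)) ≡ (y + y) + (x + ((y₁ + y₂) + (y₁ + y₂)))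
  regroup = solve 4 (λ y y₂ x y₁ → (y :+ y₂) :+ ((y :+ y₂) :+ ((x :+ (y₁ :+ y₁)) :+ con 0))
                                   := (y :+ y) :+ (x :+ ((y₁ :+ y₂) :+ (y₁ :+ y₂)))) refl
  five : ∀ y → (y + y) + (y + (y + y)) ≡ 5 * y
  five = solve 1 (λ y → (y :+ y) :+ (y :+ (y :+ y)) := con 5 :* y) refl

theorem19 : (n m : ℕ) (E : Graph n m) (π : Permutation′ n)
            (M : Assignment n m) → IsMatching E M →
            3 * size M ≤ 5 * size (algorithm E π)
theorem19 n m E π M M-matching rewrite size≡count M | size≡count (algorithm E π) =
  three-fifths opt |G| |L| y₁ y₂ opt≤|L|+y₂ opt≤|G|+2y₁ |G|≤|L| y₁+y₂≤|L|
  where open Bounds E π M M-matching
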